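{- Let $P=(P,\sqsubseteq)$ be a poset. The antichain completion $\mathscr A(P)$ is a $\vee$-semilattice, in which the join of $A,B\in\mathscr A(P)$ is the set of maximal elements of $A\cup B$. Moreover, the $\vee$-irreducible elements of $\mathscr A(P)$ are the singleton antichains, and for every $A\in\mathscr A(P)$, \[A=\bigvee_{x\in A}\{x\}\] is the unique irredundant representation of $A$ as a join of a set of $\vee$-irreducible elements.
   Context: For $X\subseteq P$, $\downarrow X=\{y\in P:\exists x\in X,\ y\sqsubseteq x\}$. $\mathscr A(P)$ is the set of antichains of $P$ ordered by $A\le B$ iff $\downarrow A\subseteq\downarrow B$ (equivalently, for every $x\in A$ there is $y\in B$ with $x\sqsubseteq y$). An element $x$ of a $\vee$-semilattice, different from the least element (if any), is $\vee$-irreducible if $x=a\vee b$ implies $x=a$ or $x=b$. A representation $A=\bigvee X$ (the join existing) with $X$ a set of $\vee$-irreducible elements is irredundant if $\bigvee Y\ne A$ for every proper subset $Y\subsetneq X$. -}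

module Defs where

open import Level using (Level; suc; _⊔_)
open import Relation.Binary.Core using (Rel)
open import Relation.Binary.Definitions using (_Respects_)
open import Relation.Binary.PropositionalEquality using (_≡_; trans; sym)
open import Relation.Unary using (Pred; _⊆_; _∪_)
open import Data.Product using (Σ; ∃; _×_; _,_; ∃-syntax)
open import Data.Sum using (_⊎_)
open import Relation.Nullary using (¬_)

module _ {a ℓ₁ ℓ₂} {A : Set a} (_≈_ : Rel A ℓ₁) (_≤_ : Rel A ℓ₂) (_∨_ : A → A → A) where

  IsLeast : A → Set (a ⊔ ℓ₂)
  IsLeast x = ∀ y → x ≤ y

  IsJoinIrreducible : A → Set (a ⊔ ℓ₁ ⊔ ℓ₂)
  IsJoinIrreducible x = ¬ IsLeast x × (∀ y z → x ≈ (y ∨ z) → (x ≈ y) ⊎ (x ≈ z))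

module AntichainCompletion {ℓ} (P : Set ℓ) (_⊑_ : Rel P ℓ) where

  ↓_ : Pred P ℓ → Pred P ℓ
  ↓ X = λ y → ∃[ x ] (X x × y ⊑ x)

  IsAntichain : Pred P ℓ → Set ℓ
  IsAntichain A = ∀ {x y} → A x → A y → x ⊑ y → x ≡ y

  record Antichain : Set (suc ℓ) where
    constructor antichain
    field
      set         : Pred P ℓ
      isAntichain : IsAntichain set
  open Antichain public

  _≤ₐ_ : Rel Antichain ℓ
  A ≤ₐ B = ↓ set A ⊆ ↓ set B

  _≐_ : Rel Antichain ℓ
  A ≐ B = set A ⊆ set B × set B ⊆ set A

  maxOf : Pred P ℓ → Pred P ℓ
  maxOf S x = S x × (∀ {y} → S y → x ⊑ y → x ≡ y)

  maxOf-antichain : ∀ S → IsAntichain (maxOf S)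
  maxOf-antichain S (_ , mx) (sy , _) x⊑y = mx sy x⊑y

  _∨ₐ_ : Antichain → Antichain → Antichain
  A ∨ₐ B = antichain (maxOf (set A ∪ set B)) (maxOf-antichain (set A ∪ set B))

  sing : P → Antichain
  sing x = antichain (λ y → y ≡ x) (λ p q _ → trans p (sym q))

  IsIrreducible : Antichain → Set (suc ℓ)
  IsIrreducible = IsJoinIrreducible _≐_ _≤ₐ_ _∨ₐ_

  IsJoinOf : Pred Antichain ℓ → Antichain → Set (suc ℓ)
  IsJoinOf X A = (∀ B → X B → B ≤ₐ A)
               × (∀ C → (∀ B → X B → B ≤ₐ C) → A ≤ₐ C)

  IsSetOf𝒜 : Pred Antichain ℓ → Set (suc ℓ)
  IsSetOf𝒜 X = X Respects _≐_

  _⊂_ : Pred Antichain ℓ → Pred Antichain ℓ → Set (suc ℓ)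
  Y ⊂ X = Y ⊆ X × ∃[ B ] (X B × ¬ Y B)

  IsRepresentation : Pred Antichain ℓ → Antichain → Set (suc ℓ)
  IsRepresentation X A = IsSetOf𝒜 X × (∀ B → X B → IsIrreducible B) × IsJoinOf X A

  IsIrredundantRep : Pred Antichain ℓ → Antichain → Set (suc ℓ)
  IsIrredundantRep X A =
    IsRepresentation X A × (∀ Y → IsSetOf𝒜 Y → Y ⊂ X → ¬ IsJoinOf Y A)

  singletonsOf : Antichain → Pred Antichain ℓ
  singletonsOf A B = ∃[ x ] (set A x × B ≐ sing x)

-- The join of two antichains is max(A ∪ B): an element of A that is not maximal in A ∪ B
-- lies strictly below some y ∈ B, and such a y is itself maximal, so ↓(A ∨ B) = ↓A ∪ ↓B.
-- A singleton {x} is irreducible because any antichain below {x} containing x is {x};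
-- conversely, a nonempty A splits as {x} ∨ (A ∖ {x}), so an irreducible A is a singleton.
-- Every A is the join of its singletons, and no proper subfamily has join A since it stays
-- below some A ∖ {x}. If X is any irredundant representation, the points of its singletons
-- form an antichain (a singleton below another one would be redundant) with the same join
-- as X, hence equal to A.
module Submission where

open import Defs
open import Data.Empty using (⊥; ⊥-elim)
open import Data.Product using (_×_; _,_; proj₁; proj₂; ∃-syntax)
open import Data.Sum using (_⊎_; inj₁; inj₂; swap)
import Relation.Binary.Reasoning.PartialOrder as PosetReasoning
open import Function.Base using (_∘_; id)
open import Function.Bundles using (_⇔_; mk⇔)
open import Level using (Lift)
open import Relation.Binary.Bundles using (Poset)
open import Relation.Binary.Core using (Rel; _⇒_)
open import Relation.Binary.Definitions using (Antisymmetric)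
open import Relation.Binary.PropositionalEquality using (_≡_; _≢_; refl; sym; subst)
open import Relation.Binary.Structures using (IsEquivalence; IsPartialOrder)
open import Relation.Binary.Lattice.Definitions using (Supremum)
open import Relation.Binary.Lattice.Structures using (IsJoinSemilattice)
open import Relation.Nullary using (¬_; yes; no)
open import Relation.Nullary.Decidable using (decidable-stable)
open import Relation.Unary using (Pred; _⊆_; _∪_)
open import Axiom.ExcludedMiddle using (ExcludedMiddle)

module AntichainCompletionProperties {ℓ} (P : Set ℓ) (_⊑_ : Rel P ℓ)
                                     (po : IsPartialOrder _≡_ _⊑_) where
  open AntichainCompletion P _⊑_
  open IsPartialOrder po using ()
    renaming (refl to ⊑-refl; trans to ⊑-trans; antisym to ⊑-antisym)

  ∈⇒∈↓ : ∀ {X x} → X x → (↓ X) x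
  ∈⇒∈↓ Xx = _ , Xx , ⊑-refl

  ↓-⊑ : ∀ {X x y} → x ⊑ y → (↓ X) y → (↓ X) x
  ↓-⊑ x⊑y (z , Xz , y⊑z) = z , Xz , ⊑-trans x⊑y y⊑z

  ≐-isEquivalence : IsEquivalence _≐_
  ≐-isEquivalence = record
    { refl  = id , id
    ; sym   = λ (A⊆B , B⊆A) → B⊆A , A⊆B
    ; trans = λ (A⊆B , B⊆A) (B⊆C , C⊆B) → B⊆C ∘ A⊆B , B⊆A ∘ C⊆B
    }

  open IsEquivalence ≐-isEquivalence
    using () renaming (refl to ≐-refl; sym to ≐-sym; trans to ≐-trans)

  ≐⇒≤ₐ : _≐_ ⇒ _≤ₐ_
  ≐⇒≤ₐ (A⊆B , _) (y , Ay , x⊑y) = y , A⊆B Ay , x⊑y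

  ≤ₐ-trans : ∀ {A B C} → A ≤ₐ B → B ≤ₐ C → A ≤ₐ C
  ≤ₐ-trans A≤B B≤C = B≤C ∘ A≤B

  ≤ₐ-antisym : Antisymmetric _≐_ _≤ₐ_
  ≤ₐ-antisym {A} {B} A≤B B≤A = ⊆-of {A} {B} A≤B B≤A , ⊆-of {B} {A} B≤A A≤B
    where
    ⊆-of : ∀ {A B} → A ≤ₐ B → B ≤ₐ A → set A ⊆ set B
    ⊆-of {A} {B} A≤B B≤A {x} Ax with A≤B (∈⇒∈↓ Ax)
    ... | y , By , x⊑y with B≤A (∈⇒∈↓ By)
    ... | z , Az , y⊑z with isAntichain A Ax Az (⊑-trans x⊑y y⊑z)
    ... | refl = subst (set B) (sym (⊑-antisym x⊑y y⊑z)) By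

  -- _≐_ and _≤ₐ_ unfold to statements about set A, from which unification cannot recover A;
  -- hence the explicitly supplied antichain arguments here and below.
  ≤ₐ-isPartialOrder : IsPartialOrder _≐_ _≤ₐ_
  ≤ₐ-isPartialOrder = record
    { isPreorder = record
      { isEquivalence = ≐-isEquivalence
      ; reflexive     = λ {A} {B} → ≐⇒≤ₐ {A} {B}
      ; trans         = λ {A} {B} {C} → ≤ₐ-trans {A} {B} {C}
      }
    ; antisym = λ {A} {B} → ≤ₐ-antisym {A} {B}
    }

  ≤ₐ-poset : Poset (Level.suc ℓ) ℓ ℓ
  ≤ₐ-poset = record { isPartialOrder = ≤ₐ-isPartialOrder }

  module ≤ₐ-Reasoning = PosetReasoning ≤ₐ-poset

  sing-≤ₐ : ∀ {A x} → (↓ set A) x → sing x ≤ₐ A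
  sing-≤ₐ x∈↓A (_ , refl , y⊑x) = ↓-⊑ y⊑x x∈↓A

  ∈∧≤ₐsing⇒≐sing : ∀ {A x} → set A x → A ≤ₐ sing x → A ≐ sing x
  ∈∧≤ₐsing⇒≐sing {A} {x} Ax A≤x =
      A⊆x , λ { refl → Ax }
    where
    A⊆x : set A ⊆ set (sing x)
    A⊆x Ay with A≤x (∈⇒∈↓ Ay)
    ... | _ , refl , y⊑x = isAntichain A Ay Ax y⊑x

  ∅ₐ : Antichain
  ∅ₐ = antichain (λ _ → Lift ℓ ⊥) (λ ())

  IsLeastₐ : Antichain → Set (Level.suc ℓ)
  IsLeastₐ = IsLeast _≐_ _≤ₐ_ _∨ₐ_

  ∈⇒¬IsLeastₐ : ∀ {A x} → set A x → ¬ IsLeastₐ A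
  ∈⇒¬IsLeastₐ Ax least with least ∅ₐ (∈⇒∈↓ Ax)
  ... | _ , () , _

  empty⇒IsLeastₐ : ∀ {A} → ¬ (∃[ x ] set A x) → IsLeastₐ A
  empty⇒IsLeastₐ A≢∅ _ (y , Ay , _) = ⊥-elim (A≢∅ (y , Ay))

  _∖ₐ_ : Antichain → P → Antichain
  A ∖ₐ x = antichain (λ y → set A y × y ≢ x) (λ (Ay , _) (Az , _) → isAntichain A Ay Az)

  ¬≤ₐ∖ₐ : ∀ {A x} → set A x → ¬ (A ≤ₐ (A ∖ₐ x))
  ¬≤ₐ∖ₐ {A} Ax A≤A∖x with A≤A∖x (∈⇒∈↓ Ax)
  ... | y , (Ay , y≢x) , x⊑y = y≢x (sym (isAntichain A Ax Ay x⊑y))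

  ∨ₐ-comm-⊆ : ∀ A B → set (A ∨ₐ B) ⊆ set (B ∨ₐ A)
  ∨ₐ-comm-⊆ A B (AB , maximal) = swap AB , λ BA → maximal (swap BA)

  IsJoinOf-unique : ∀ {X A B} → IsJoinOf X A → IsJoinOf X B → A ≐ B
  IsJoinOf-unique {A = A} {B} (upperA , leastA) (upperB , leastB) =
    ≤ₐ-antisym {A} {B} (leastA B upperB) (leastB A upperA)

  IsJoinOf-cofinal : ∀ {X Y A} → Y ⊆ X → (∀ B → X B → ∃[ C ] (Y C × B ≤ₐ C)) →
                     IsJoinOf X A → IsJoinOf Y A
  IsJoinOf-cofinal Y⊆X cofinal (upper , least) =
      (λ B YB → upper B (Y⊆X YB))
    , λ C boundY → least C λ B XB →
        let (D , YD , B≤D) = cofinal B XB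
        in begin B ≤⟨ B≤D ⟩ D ≤⟨ boundY D YD ⟩ C ∎
    where open ≤ₐ-Reasoning

  singletonsOf-isJoinOf : ∀ A → IsJoinOf (singletonsOf A) A
  singletonsOf-isJoinOf A =
      (λ { B (x , Ax , B≐x) → begin B ≈⟨ B≐x ⟩ sing x ≤⟨ sing-≤ₐ {A} (∈⇒∈↓ {x = x} Ax) ⟩ A ∎ })
    , λ C bound (y , Ay , x⊑y) → bound (sing y) (y , Ay , ≐-refl {sing y}) (y , refl , x⊑y)
    where open ≤ₐ-Reasoning

  singletonsOf-resp : ∀ {A A′} → A ≐ A′ → singletonsOf A ⊆ singletonsOf A′
  singletonsOf-resp (A⊆A′ , _) (x , Ax , B≐x) = x , A⊆A′ Ax , B≐x

  singletonsOf-isSetOf𝒜 : ∀ A → IsSetOf𝒜 (singletonsOf A)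
  singletonsOf-isSetOf𝒜 A {B} {B′} B≐B′ (x , Ax , B≐x) =
    x , Ax , (begin-equality B′ ≈⟨ B≐B′ ⟨ B ≈⟨ B≐x ⟩ sing x ∎)
    where open ≤ₐ-Reasoning

  singletonsOf-irredundant : ∀ A Y → IsSetOf𝒜 Y → Y ⊂ singletonsOf A → ¬ IsJoinOf Y A
  singletonsOf-irredundant A Y Y-resp (Y⊆ , B , (x , Ax , B≐x) , ¬YB) (_ , least) =
    ¬≤ₐ∖ₐ {A} Ax (least (A ∖ₐ x) below)
    where
    below : ∀ B′ → Y B′ → B′ ≤ₐ (A ∖ₐ x)
    below B′ YB′ (y , B′y , z⊑y) with Y⊆ YB′
    ... | x′ , Ax′ , B′≐x′@(B′⊆x′ , _) with B′⊆x′ B′y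
    ... | refl = y , (Ax′ , x′≢x) , z⊑y
      where
      open ≤ₐ-Reasoning
      x′≢x : x′ ≢ x
      x′≢x refl = ¬YB (Y-resp (begin-equality B′ ≈⟨ B′≐x′ ⟩ sing x ≈⟨ B≐x ⟨ B ∎) YB′)

  module _ (em : ExcludedMiddle ℓ) where

    ∈ˡ⇒∈↓∨ₐ : ∀ A B {x} → set A x → (↓ set (A ∨ₐ B)) x
    ∈ˡ⇒∈↓∨ₐ A B {x} Ax with em {∃[ y ] (set B y × x ⊑ y × x ≢ y)}
    ... | no ¬above = x , (inj₁ Ax , x-maximal) , ⊑-refl
      where
      x-maximal : ∀ {z} → (set A ∪ set B) z → x ⊑ z → x ≡ z
      x-maximal (inj₁ Az) x⊑z = isAntichain A Ax Az x⊑z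
      x-maximal (inj₂ Bz) x⊑z = decidable-stable em λ x≢z → ¬above (_ , Bz , x⊑z , x≢z)
    ... | yes (y , By , x⊑y , x≢y) = y , (inj₂ By , y-maximal) , x⊑y
      where
      y-maximal : ∀ {z} → (set A ∪ set B) z → y ⊑ z → y ≡ z
      y-maximal (inj₂ Bz) y⊑z = isAntichain B By Bz y⊑z
      y-maximal (inj₁ Az) y⊑z with isAntichain A Ax Az (⊑-trans x⊑y y⊑z)
      ... | refl = ⊥-elim (x≢y (⊑-antisym x⊑y y⊑z))

    ∨ₐ-supremum : Supremum _≤ₐ_ _∨ₐ_
    ∨ₐ-supremum A B = upperˡ A B , upperʳ , least
      where
      upperˡ : ∀ A B → A ≤ₐ (A ∨ₐ B)
      upperˡ A B (y , Ay , x⊑y) = ↓-⊑ x⊑y (∈ˡ⇒∈↓∨ₐ A B Ay)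
      upperʳ : B ≤ₐ (A ∨ₐ B)
      upperʳ x∈↓B with upperˡ B A x∈↓B
      ... | y , y∈B∨A , x⊑y = y , ∨ₐ-comm-⊆ B A y∈B∨A , x⊑y
      least : ∀ C → A ≤ₐ C → B ≤ₐ C → (A ∨ₐ B) ≤ₐ C
      least C A≤C B≤C (y , (inj₁ Ay , _) , x⊑y) = A≤C (y , Ay , x⊑y)
      least C A≤C B≤C (y , (inj₂ By , _) , x⊑y) = B≤C (y , By , x⊑y)

    ∨ₐ-isJoinSemilattice : IsJoinSemilattice _≐_ _≤ₐ_ _∨ₐ_
    ∨ₐ-isJoinSemilattice = record
      { isPartialOrder = ≤ₐ-isPartialOrder
      ; supremum       = ∨ₐ-supremum
      }

    sing-isIrreducible : ∀ A {x} → A ≐ sing x → IsIrreducible A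
    sing-isIrreducible A {x} A≐x = ∈⇒¬IsLeastₐ {A} (proj₂ A≐x refl) , split
      where
      open ≤ₐ-Reasoning
      ≐-of-∈∧≤ₐ : ∀ {D} → set D x → D ≤ₐ A → A ≐ D
      ≐-of-∈∧≤ₐ {D} Dx D≤A = begin-equality A ≈⟨ A≐x ⟩ sing x ≈⟨ D≐x ⟨ D ∎
        where D≐x = ∈∧≤ₐsing⇒≐sing {D} Dx (begin D ≤⟨ D≤A ⟩ A ≈⟨ A≐x ⟩ sing x ∎)
      split : ∀ B C → A ≐ (B ∨ₐ C) → (A ≐ B) ⊎ (A ≐ C)
      split B C A≐B∨C with proj₁ A≐B∨C (proj₂ A≐x refl) | ∨ₐ-supremum B C
      ... | inj₁ Bx , _ | B≤B∨C , _ =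
        inj₁ (≐-of-∈∧≤ₐ {B} Bx (begin B ≤⟨ B≤B∨C ⟩ B ∨ₐ C ≈⟨ A≐B∨C ⟨ A ∎))
      ... | inj₂ Cx , _ | _ , C≤B∨C , _ =
        inj₂ (≐-of-∈∧≤ₐ {C} Cx (begin C ≤⟨ C≤B∨C ⟩ B ∨ₐ C ≈⟨ A≐B∨C ⟨ A ∎))

    ≐sing-∨ₐ-∖ₐ : ∀ {A x} → set A x → A ≐ (sing x ∨ₐ (A ∖ₐ x))
    ≐sing-∨ₐ-∖ₐ {A} {x} Ax = split , ⊆A ∘ proj₁
      where
      ⊆A : (set (sing x) ∪ set (A ∖ₐ x)) ⊆ set A
      ⊆A (inj₁ refl)     = Ax
      ⊆A (inj₂ (Ay , _)) = Ay
      split : set A ⊆ set (sing x ∨ₐ (A ∖ₐ x))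
      split {y} Ay with em {y ≡ x}
      ... | yes y≡x = inj₁ y≡x , λ Sz → isAntichain A Ay (⊆A Sz)
      ... | no y≢x  = inj₂ (Ay , y≢x) , λ Sz → isAntichain A Ay (⊆A Sz)

    isIrreducible⇒sing : ∀ A → IsIrreducible A → ∃[ x ] (A ≐ sing x)
    isIrreducible⇒sing A (¬least , split) with em {∃[ x ] set A x}
    ... | no A≢∅ = ⊥-elim (¬least (empty⇒IsLeastₐ {A} A≢∅))
    ... | yes (x , Ax) with split (sing x) (A ∖ₐ x) (≐sing-∨ₐ-∖ₐ {A} Ax)
    ...   | inj₁ A≐x        = x , A≐x
    ...   | inj₂ (A⊆A∖x , _) = ⊥-elim (proj₂ (A⊆A∖x Ax) refl)

    isIrreducible⇔sing : ∀ A → IsIrreducible A ⇔ (∃[ x ] (A ≐ sing x))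
    isIrreducible⇔sing A = mk⇔ (isIrreducible⇒sing A) λ (_ , A≐x) → sing-isIrreducible A A≐x

    singletonsOf-isIrredundantRep : ∀ A → IsIrredundantRep (singletonsOf A) A
    singletonsOf-isIrredundantRep A =
        ( (λ {B} {B′} → singletonsOf-isSetOf𝒜 A {B} {B′})
        , (λ { B (_ , _ , B≐x) → sing-isIrreducible B B≐x })
        , singletonsOf-isJoinOf A )
      , singletonsOf-irredundant A

    irredundant⇒points-antichain : ∀ {X A} → IsIrredundantRep X A →
                                   IsAntichain (λ y → X (sing y))
    irredundant⇒points-antichain {X} {A} ((X-resp , _ , joinX) , irredundant)
                                 {y} {y′} Xy Xy′ y⊑y′ =
      decidable-stable em λ y≢y′ →
        irredundant Y Y-resp (proj₁ , sing y , Xy , λ (_ , ¬y≐y) → ¬y≐y (≐-refl {sing y}))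
                    (IsJoinOf-cofinal {Y = Y} {A = A} proj₁ (cofinal y≢y′) joinX)
      where
      Y : Pred Antichain ℓ
      Y B = X B × ¬ (B ≐ sing y)
      Y-resp : IsSetOf𝒜 Y
      Y-resp {B} {B′} B≐B′ (XB , ¬B≐y) =
        X-resp B≐B′ XB , λ B′≐y → ¬B≐y (≐-trans {B} {B′} {sing y} B≐B′ B′≐y)
      cofinal : y ≢ y′ → ∀ B → X B → ∃[ C ] (Y C × B ≤ₐ C)
      cofinal y≢y′ B XB with em {B ≐ sing y}
      ... | no ¬B≐y = B , (XB , ¬B≐y) , id
      ... | yes B≐y =
        sing y′ , (Xy′ , λ (y′⊆y , _) → y≢y′ (sym (y′⊆y refl)))
        , (begin B ≈⟨ B≐y ⟩ sing y ≤⟨ sing-≤ₐ {sing y′} (y′ , refl , y⊑y′) ⟩ sing y′ ∎)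
        where open ≤ₐ-Reasoning

    irredundantRep-unique : ∀ A X → IsIrredundantRep X A → ∀ B → X B ⇔ singletonsOf A B
    irredundantRep-unique A X irrRep@((X-resp , X-irreducible , joinX) , _) B =
      mk⇔ (singletonsOf-resp {U} {A} (≐-sym {A} {U} A≐U) {B} ∘ X⊆ {B})
          (⊆X {B} ∘ singletonsOf-resp {A} {U} A≐U {B})
      where
      U : Antichain
      U = antichain (λ y → X (sing y)) (irredundant⇒points-antichain {X} {A} irrRep)
      X⊆ : X ⊆ singletonsOf U
      X⊆ {B} XB with isIrreducible⇒sing B (X-irreducible B XB)
      ... | y , B≐y = y , X-resp {B} {sing y} B≐y XB , B≐y
      ⊆X : singletonsOf U ⊆ X
      ⊆X {B} (y , Xy , B≐y) = X-resp {sing y} {B} (≐-sym {B} {sing y} B≐y) Xy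
      A≐U : A ≐ U
      A≐U = IsJoinOf-unique {X} {A} {U} joinX
              (IsJoinOf-cofinal {singletonsOf U} {X} {U} X⊆ (λ B SB → B , ⊆X SB , id)
                                (singletonsOf-isJoinOf U))

theorem2 : ∀ {ℓ} (P : Set ℓ) (_⊑_ : Rel P ℓ) → IsPartialOrder _≡_ _⊑_ → ExcludedMiddle ℓ →
    let open AntichainCompletion P _⊑_ in
    IsJoinSemilattice _≐_ _≤ₐ_ _∨ₐ_
    × (∀ A → IsIrreducible A ⇔ (∃[ x ] (A ≐ sing x)))
    × (∀ A → IsIrredundantRep (singletonsOf A) A
    × (∀ X → IsIrredundantRep X A → ∀ B → X B ⇔ singletonsOf A B))
theorem2 P _⊑_ po em =
    ∨ₐ-isJoinSemilattice em
  , isIrreducible⇔sing em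
  , λ A → singletonsOf-isIrredundantRep em A , irredundantRep-unique em A
  where open AntichainCompletionProperties P _⊑_ po
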